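{- The operations defined by a bipointed NDA (SOS) specification on the final coalgebra of the $\mathsf{Set}$ functor $FX = 2 \times \mathcal{P}_\mathsf{f}(X)^A$, where $A$ is a finite set, restrict to the rational fixpoint of $F$.
   Context: Coalgebras for $FX = 2 \times (\mathcal{P}_\mathsf{f} X)^A$ on $\mathsf{Set}$ ($\mathcal{P}_\mathsf{f}$ the finite powerset functor) are non-deterministic automata with input alphabet $A$. Let $\Sigma$ be a signature with finitely many operation symbols of finite arity, viewed as a polynomial functor on $\mathsf{Set}$. A bipointed NDA specification is a natural transformation with components $\lambda_X: \Sigma(2 \times \mathcal{P}_\mathsf{f}(X)^A \times X) \to 2 \times \mathcal{P}_\mathsf{f}(\Sigma X + X)^A$; it induces operations on the final coalgebra $(\nu F, t)$ as the unique algebra $\alpha: \Sigma(\nu F) \to \nu F$ with $t \circ \alpha = F[\alpha, id] \circ \lambda_{\nu F} \circ \Sigma\langle t, id\rangle$. A bipointed NDA SOS specification (a collection of flat GSOS-style transition rules whose conclusions have a variable or a single operation symbol applied to variables as target, together with output rules, satisfying finiteness/uniqueness conditions) gives rise to such a natural transformation. The rational fixpoint $\rho F$ is the final locally finitely presentable $F$-coalgebra; here it is the coproduct of all finite $F$-coalgebras modulo the largest bisimulation, a subcoalgebra of $\nu F$. "Restrict" means that there is an algebra structure $\beta: \Sigma(\rho F) \to \rho F$ such that the unique coalgebra homomorphism $\rho F \to \nu F$ is a $\Sigma$-algebra homomorphism from $(\rho F,\beta)$ to $(\nu F,\alpha)$. -}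

module Defs where

open import Level using (Level; 0ℓ) renaming (suc to lsuc)
open import Function using (_∘_; id)
open import Data.Bool using (Bool)
open import Data.Nat using (ℕ)
open import Data.Fin using (Fin)
open import Data.List using (List; map)
open import Data.List.Relation.Unary.All using (All)
open import Data.List.Relation.Unary.Any using (Any)
open import Data.Product using (Σ; Σ-syntax; _×_; _,_; proj₁; proj₂)
open import Data.Sum using (_⊎_; [_,_]) renaming (map to ⊎-map)
open import Data.Sum.Relation.Binary.Pointwise using (Pointwise)
open import Relation.Binary.Core using (REL; Rel)
open import Relation.Binary.Bundles using (Setoid)
open import Relation.Binary.PropositionalEquality using (_≡_)

-- Conventions: Set is modelled by setoids (carrier in Set, equality at
-- level 1ℓ); the finite powerset P_f X is modelled by List X modulo
-- "same elements up to the equality of X". The finite alphabet A is Fin m.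

1ℓ : Level
1ℓ = lsuc 0ℓ

PfRel : ∀ {ℓ} {X Y : Set} → REL X Y ℓ → REL (List X) (List Y) ℓ
PfRel R xs ys =
  All (λ x → Any (λ y → R x y) ys) xs × All (λ y → Any (λ x → R x y) xs) ys

FObj : ℕ → Set → Set
FObj m X = Bool × (Fin m → List X)

FMap : ∀ {m} {X Y : Set} → (X → Y) → FObj m X → FObj m Y
FMap f (b , g) = b , (λ a → map f (g a))

FRel : ∀ {ℓ} (m : ℕ) {X Y : Set} → REL X Y ℓ → REL (FObj m X) (FObj m Y) ℓ
FRel m R (b , g) (b' , g') = (b ≡ b') × (∀ (a : Fin m) → PfRel R (g a) (g' a))

-- L X = 2 × (P_f X)^A × X   (the argument type of a bipointed spec)
LObj : ℕ → Set → Set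
LObj m X = Bool × (Fin m → List X) × X

LMap : ∀ {m} {X Y : Set} → (X → Y) → LObj m X → LObj m Y
LMap f (b , g , x) = b , (λ a → map f (g a)) , f x

LRel : ∀ {ℓ} (m : ℕ) {X Y : Set} → REL X Y ℓ → REL (LObj m X) (LObj m Y) ℓ
LRel m R (b , g , x) (b' , g' , x') = FRel m R (b , g) (b' , g') × R x x'

record Signature : Set where
  field
    nops  : ℕ
    arity : Fin nops → ℕ
open Signature public

Sig : Signature → Set → Set
Sig S X = Σ[ o ∈ Fin (nops S) ] (Fin (arity S o) → X)

SigMap : ∀ (S : Signature) {X Y : Set} → (X → Y) → Sig S X → Sig S Y
SigMap S f (o , xs) = o , (f ∘ xs)

data SigRel {ℓ} (S : Signature) {X Y : Set} (R : REL X Y ℓ) :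
            REL (Sig S X) (Sig S Y) ℓ where
  sig-rel : ∀ {o} {xs : Fin (arity S o) → X} {ys : Fin (arity S o) → Y} →
            (∀ i → R (xs i) (ys i)) → SigRel S R (o , xs) (o , ys)

record Coalg (m : ℕ) : Set₂ where
  field
    setoid   : Setoid 0ℓ 1ℓ
  open Setoid setoid public using (Carrier; _≈_)
  field
    str      : Carrier → FObj m Carrier
    str-cong : ∀ {x y} → x ≈ y → FRel m _≈_ (str x) (str y)

IsHom : ∀ (m : ℕ) {X Y : Set} (_≈X_ : Rel X 1ℓ) (c : X → FObj m X)
          (_≈Y_ : Rel Y 1ℓ) (d : Y → FObj m Y) (f : X → Y) → Set₁
IsHom m _≈X_ c _≈Y_ d f =
  (∀ {x y} → x ≈X y → f x ≈Y f y) ×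
  (∀ x → FRel m _≈Y_ (FMap f (c x)) (d (f x)))

IsCoalgHom : ∀ {m} (C D : Coalg m) → (Coalg.Carrier C → Coalg.Carrier D) → Set₁
IsCoalgHom {m} C D = IsHom m (Coalg._≈_ C) (Coalg.str C) (Coalg._≈_ D) (Coalg.str D)

IsFinal : ∀ {m} → Coalg m → Set₂
IsFinal {m} D = ∀ (C : Coalg m) →
  Σ (Coalg.Carrier C → Coalg.Carrier D) (IsCoalgHom C D) ×
  (∀ (f g : Coalg.Carrier C → Coalg.Carrier D) →
     IsCoalgHom C D f → IsCoalgHom C D g →
     ∀ x → Coalg._≈_ D (f x) (g x))

-- Rational fixpoint: coproduct of all finite coalgebras modulo the
-- largest bisimulation (every finite coalgebra is iso to one on Fin n).

record Rat (m : ℕ) : Set where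
  constructor rat
  field
    size  : ℕ
    trans : Fin size → FObj m (Fin size)
    state : Fin size

IsBisim : ∀ {m n k} → (Fin n → FObj m (Fin n)) → (Fin k → FObj m (Fin k)) →
          (Fin n → Fin k → Set) → Set
IsBisim {m} c d R = ∀ x y → R x y → FRel m R (c x) (d y)

_≈ρ_ : ∀ {m} → Rel (Rat m) 1ℓ
rat n c i ≈ρ rat k d j = Σ[ R ∈ (Fin n → Fin k → Set) ] (IsBisim c d R × R i j)

ratStr : ∀ {m} → Rat m → FObj m (Rat m)
ratStr (rat n c i) = FMap (rat n c) (c i)

record BipointedSpec (m : ℕ) (S : Signature) : Set₂ where
  field
    lam : (X : Setoid 0ℓ 1ℓ) →
          Sig S (LObj m (Setoid.Carrier X)) →
          FObj m (Sig S (Setoid.Carrier X) ⊎ Setoid.Carrier X)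
    lam-cong : (X : Setoid 0ℓ 1ℓ) → ∀ {u v} →
          SigRel S (LRel m (Setoid._≈_ X)) u v →
          FRel m (Pointwise (SigRel S (Setoid._≈_ X)) (Setoid._≈_ X))
                 (lam X u) (lam X v)
    lam-natural : (X Y : Setoid 0ℓ 1ℓ)
          (f : Setoid.Carrier X → Setoid.Carrier Y) →
          (∀ {x y} → Setoid._≈_ X x y → Setoid._≈_ Y (f x) (f y)) →
          ∀ u →
          FRel m (Pointwise (SigRel S (Setoid._≈_ Y)) (Setoid._≈_ Y))
                 (FMap (⊎-map (SigMap S f) f) (lam X u))
                 (lam Y (SigMap S (LMap f) u))
open BipointedSpec public

IsInducedAlgebra : ∀ {m S} → BipointedSpec m S → (N : Coalg m) →
                   (Sig S (Coalg.Carrier N) → Coalg.Carrier N) → Set₁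
IsInducedAlgebra {m} {S} spec N α =
  (∀ {u v} → SigRel S _≈_ u v → α u ≈ α v) ×
  (∀ u → FRel m _≈_ (str (α u))
           (FMap [ α , id ] (lam spec setoid
              (SigMap S (λ x → proj₁ (str x) , proj₂ (str x) , x) u))))
  where open Coalg N

module Submission where

-- For an operation σ of arity n and
-- r₁,…,rₙ ∈ ρF we form the disjoint union U of the finite coalgebras of the
-- rᵢ and the coalgebra of flat terms ΣU + U whose structure is given by λ;
-- it is again finite, and β σ(r₁,…,rₙ) is its state σ(r₁,…,rₙ).
--   * Naturality of λ and the defining equation of α make [α ∘ Σh , h] a
--     homomorphism out of the term coalgebra, so by finality of νF,
--     h (β σ(r⃗)) = α σ(h r⃗): h is a Σ-algebra homomorphism.
--   * h reflects equality: its kernel is a bisimulation, and bisimulations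
--     between finite coalgebras are contained in bisimilarity ≈ρ, which is
--     computed by partition refinement.  Hence β respects ≈ρ.

open import Level using (Level; 0ℓ; Lift; lift)
open import Function using (_∘_; id)
open import Data.Bool.Properties using () renaming (_≟_ to _≟ᵇ_)
open import Data.Nat using (ℕ; zero; suc; _+_; _^_; _<_)
open import Data.Nat.Induction using (<-wellFounded)
open import Data.Fin using (Fin; zero; suc; _↑ˡ_; _↑ʳ_; splitAt; join; finToFun; funToFin)
open import Data.Fin.Properties
  using (all?; splitAt-↑ˡ; splitAt-↑ʳ; finToFun-funToFin)
  renaming (_≟_ to _≟ᶠ_)
open import Data.List using (List; map; length; filter; allFin; cartesianProduct)
open import Data.List.Properties using (filter-notAll)
open import Data.List.Relation.Unary.All as All using (All)
import Data.List.Relation.Unary.All.Properties as AllP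
open import Data.List.Relation.Unary.Any as Any using (Any)
import Data.List.Relation.Unary.Any.Properties as AnyP
open import Data.List.Membership.Propositional.Properties
  using (∈-filter⁺; ∈-cartesianProduct⁺; ∈-allFin)
open import Data.Product using (Σ; Σ-syntax; _×_; _,_; proj₁; proj₂)
open import Data.Product.Properties using (≡-dec)
open import Data.Sum using (_⊎_; inj₁; inj₂; [_,_]; [_,_]′) renaming (map to ⊎-map)
open import Data.Sum.Relation.Binary.Pointwise using (Pointwise; inj₁; inj₂; ⊎-transitive)
open import Induction.WellFounded using (Acc; acc)
open import Relation.Nullary using (Dec; yes; no)
open import Relation.Nullary.Decidable using (_×-dec_)
open import Relation.Unary using (Decidable)
open import Relation.Binary.Core using (REL; Rel)
open import Relation.Binary.Bundles using (Setoid)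
import Relation.Binary.Reasoning.Setoid as SetoidReasoning
open import Relation.Binary.PropositionalEquality as ≡ using (_≡_)
open import Defs

private variable
  ℓ ℓ' ℓ'' : Level
  m : ℕ
  A B X Y Z X' Y' : Set

PfRel-mono : {R : REL X Y ℓ} {Q : REL X Y ℓ'} → (∀ {x y} → R x y → Q x y) →
             ∀ {xs ys} → PfRel R xs ys → PfRel Q xs ys
PfRel-mono f (forth , back) = All.map (Any.map f) forth , All.map (Any.map f) back

PfRel-refl : {R : REL X X ℓ} → (∀ x → R x x) → ∀ xs → PfRel R xs xs
PfRel-refl r xs = All.tabulate (Any.map λ { ≡.refl → r _ }) ,
                  All.tabulate (Any.map λ { ≡.refl → r _ })

PfRel-sym : {R : REL X Y ℓ} {Q : REL Y X ℓ'} → (∀ {x y} → R x y → Q y x) →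
            ∀ {xs ys} → PfRel R xs ys → PfRel Q ys xs
PfRel-sym f (forth , back) = All.map (Any.map f) back , All.map (Any.map f) forth

PfRel-trans : {R : REL X Y ℓ} {Q : REL Y Z ℓ'} {W : REL X Z ℓ''} →
              (∀ {x y z} → R x y → Q y z → W x z) →
              ∀ {xs ys zs} → PfRel R xs ys → PfRel Q ys zs → PfRel W xs zs
PfRel-trans {R = R} {Q} {W} t {xs} {ys} {zs} (forthR , backR) (forthQ , backQ) =
  All.map (λ r → compose r forthQ) forthR , All.map (λ q → compose⁻ q backR) backQ
  where
  compose : ∀ {x ys'} → Any (R x) ys' → All (λ y → Any (Q y) zs) ys' → Any (W x) zs
  compose (Any.here r) (q All.∷ _) = Any.map (t r) q
  compose (Any.there r) (_ All.∷ qs) = compose r qs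
  compose⁻ : ∀ {z ys'} → Any (λ y → Q y z) ys' → All (λ y → Any (λ x → R x y) xs) ys' →
             Any (λ x → W x z) xs
  compose⁻ (Any.here q) (r All.∷ _) = Any.map (λ r' → t r' q) r
  compose⁻ (Any.there q) (_ All.∷ rs) = compose⁻ q rs

PfRel-mapˡ : {R : REL X Y ℓ} {f : X' → X} → ∀ {xs ys} →
             PfRel (λ x y → R (f x) y) xs ys → PfRel R (map f xs) ys
PfRel-mapˡ (forth , back) = AllP.map⁺ forth , All.map AnyP.map⁺ back

PfRel-mapˡ⁻ : {R : REL X Y ℓ} {f : X' → X} → ∀ {xs ys} →
              PfRel R (map f xs) ys → PfRel (λ x y → R (f x) y) xs ys
PfRel-mapˡ⁻ (forth , back) = AllP.map⁻ forth , All.map AnyP.map⁻ back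

PfRel-mapʳ : {R : REL X Y ℓ} {f : Y' → Y} → ∀ {xs ys} →
             PfRel (λ x y → R x (f y)) xs ys → PfRel R xs (map f ys)
PfRel-mapʳ (forth , back) = All.map AnyP.map⁺ forth , AllP.map⁺ back

PfRel-mapʳ⁻ : {R : REL X Y ℓ} {f : Y' → Y} → ∀ {xs ys} →
              PfRel R xs (map f ys) → PfRel (λ x y → R x (f y)) xs ys
PfRel-mapʳ⁻ (forth , back) = All.map AnyP.map⁻ forth , AllP.map⁻ back

FRel-mono : {R : REL X Y ℓ} {Q : REL X Y ℓ'} → (∀ {x y} → R x y → Q x y) →
            ∀ {u v} → FRel m R u v → FRel m Q u v
FRel-mono f (b≡b' , rel) = b≡b' , λ a → PfRel-mono f (rel a)

FRel-refl : {R : REL X X ℓ} → (∀ x → R x x) → ∀ u → FRel m R u u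
FRel-refl r (b , succ) = ≡.refl , λ a → PfRel-refl r (succ a)

FRel-sym : {R : REL X Y ℓ} {Q : REL Y X ℓ'} → (∀ {x y} → R x y → Q y x) →
           ∀ {u v} → FRel m R u v → FRel m Q v u
FRel-sym f (b≡b' , rel) = ≡.sym b≡b' , λ a → PfRel-sym f (rel a)

FRel-trans : {R : REL X Y ℓ} {Q : REL Y Z ℓ'} {W : REL X Z ℓ''} →
             (∀ {x y z} → R x y → Q y z → W x z) →
             ∀ {u v w} → FRel m R u v → FRel m Q v w → FRel m W u w
FRel-trans t (b≡b' , rel) (b'≡b'' , rel') =
  ≡.trans b≡b' b'≡b'' , λ a → PfRel-trans t (rel a) (rel' a)

FRel-mapˡ : {R : REL X Y ℓ} {f : X' → X} → ∀ {u v} →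
            FRel m (λ x y → R (f x) y) u v → FRel m R (FMap f u) v
FRel-mapˡ (b≡b' , rel) = b≡b' , λ a → PfRel-mapˡ (rel a)

FRel-mapˡ⁻ : {R : REL X Y ℓ} {f : X' → X} → ∀ {u v} →
             FRel m R (FMap f u) v → FRel m (λ x y → R (f x) y) u v
FRel-mapˡ⁻ (b≡b' , rel) = b≡b' , λ a → PfRel-mapˡ⁻ (rel a)

FRel-mapʳ : {R : REL X Y ℓ} {f : Y' → Y} → ∀ {u v} →
            FRel m (λ x y → R x (f y)) u v → FRel m R u (FMap f v)
FRel-mapʳ (b≡b' , rel) = b≡b' , λ a → PfRel-mapʳ (rel a)

FRel-mapʳ⁻ : {R : REL X Y ℓ} {f : Y' → Y} → ∀ {u v} →
             FRel m R u (FMap f v) → FRel m (λ x y → R x (f y)) u v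
FRel-mapʳ⁻ (b≡b' , rel) = b≡b' , λ a → PfRel-mapʳ⁻ (rel a)

FRel-map-∘ˡ : {R : REL X Y ℓ} {f : Y' → X} {g : X' → Y'} → ∀ {u v} →
              FRel m R (FMap f (FMap g u)) v → FRel m R (FMap (f ∘ g) u) v
FRel-map-∘ˡ = FRel-mapˡ ∘ FRel-mapˡ⁻ ∘ FRel-mapˡ⁻

FRel-map-∘ˡ⁻ : {R : REL X Y ℓ} {f : Y' → X} {g : X' → Y'} → ∀ {u v} →
               FRel m R (FMap (f ∘ g) u) v → FRel m R (FMap f (FMap g u)) v
FRel-map-∘ˡ⁻ = FRel-mapˡ ∘ FRel-mapˡ ∘ FRel-mapˡ⁻

FRel-dec : {R : REL X Y ℓ} → (∀ x y → Dec (R x y)) → ∀ u v → Dec (FRel m R u v)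
FRel-dec {R = R} R? (b , succ) (b' , succ') =
  (b ≟ᵇ b') ×-dec all? (λ a → PfRel-dec (succ a) (succ' a))
  where
  PfRel-dec : ∀ xs ys → Dec (PfRel R xs ys)
  PfRel-dec xs ys = All.all? (λ x → Any.any? (R? x) ys) xs
              ×-dec All.all? (λ y → Any.any? (λ x → R? x y) xs) ys

-- Bisimilarity of states of finite coalgebras is witnessed by a relation in
-- Set: the greatest bisimulation is computed by partition refinement,
-- starting from all pairs and discarding pairs whose successors are not
-- related, until nothing changes.  The list of remaining pairs shrinks at
-- every step that is not stable, so the refinement terminates.

module GreatestBisimulation {n k : ℕ}
  (c : Fin n → FObj m (Fin n)) (d : Fin k → FObj m (Fin k)) where

  open import Data.List.Membership.DecPropositional (≡-dec (_≟ᶠ_ {n}) (_≟ᶠ_ {k}))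
    using (_∈_; _∈?_)

  Pair : Set
  Pair = Fin n × Fin k

  _∋_,_ : List Pair → Fin n → Fin k → Set
  (P ∋ x , y) = (x , y) ∈ P

  Consistent : List Pair → Pair → Set
  Consistent P (x , y) = FRel m (P ∋_,_) (c x) (d y)

  consistent? : ∀ P → Decidable (Consistent P)
  consistent? P (x , y) = FRel-dec (λ x' y' → (x' , y') ∈? P) (c x) (d y)

  refine : List Pair → List Pair
  refine P = filter (consistent? P) P

  module _ (K : Fin n → Fin k → Set ℓ)
           (K-bisim : ∀ x y → K x y → FRel m K (c x) (d y)) where

    refine-keeps : ∀ P → (∀ {x y} → K x y → P ∋ x , y) →
                   ∀ {x y} → K x y → refine P ∋ x , y
    refine-keeps P K⊆P {x} {y} xKy =
      ∈-filter⁺ (consistent? P) (K⊆P xKy) (FRel-mono K⊆P (K-bisim x y xKy))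

    stabilise : ∀ P → Acc _<_ (length P) → (∀ {x y} → K x y → P ∋ x , y) →
                Σ[ Q ∈ List Pair ] (IsBisim c d (Q ∋_,_) × (∀ {x y} → K x y → Q ∋ x , y))
    stabilise P (acc smaller) K⊆P with All.all? (consistent? P) P
    ... | yes stable = P , (λ x y xPy → All.lookup stable xPy) , K⊆P
    ... | no unstable = stabilise (refine P)
      (smaller (filter-notAll (consistent? P) P (AllP.¬All⇒Any¬ (consistent? P) P unstable)))
      (refine-keeps P K⊆P)

    bisimulation⇒≈ρ : ∀ i j → K i j → rat n c i ≈ρ rat k d j
    bisimulation⇒≈ρ i j iKj =
      let (Q , Q-bisim , K⊆Q) = stabilise all-pairs (<-wellFounded _) all-pairs-complete
      in (Q ∋_,_) , Q-bisim , K⊆Q iKj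
      where
      all-pairs : List Pair
      all-pairs = cartesianProduct (allFin n) (allFin k)
      all-pairs-complete : ∀ {x y} → K x y → all-pairs ∋ x , y
      all-pairs-complete {x} {y} _ = ∈-cartesianProduct⁺ (∈-allFin x) (∈-allFin y)

-- Finite coalgebras on such types can be transported to Fin size.

record Enumeration (A : Set) (_~_ : Rel A ℓ) : Set ℓ where
  field
    size          : ℕ
    encode        : A → Fin size
    decode        : Fin size → A
    decode-encode : ∀ a → decode (encode a) ~ a

weaken : {R : Rel A ℓ} {Q : Rel A ℓ'} → (∀ {a a'} → R a a' → Q a a') →
         Enumeration A R → Enumeration A Q
weaken R⇒Q E = record { Enumeration E; decode-encode = R⇒Q ∘ Enumeration.decode-encode E }

Fin-enumeration : (n : ℕ) → Enumeration (Fin n) _≡_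
Fin-enumeration n = record { size = n ; encode = λ i → i ; decode = λ i → i
                           ; decode-encode = λ _ → ≡.refl }

⊎-enumeration : {R : Rel A ℓ} {Q : Rel B ℓ'} →
                Enumeration A R → Enumeration B Q → Enumeration (A ⊎ B) (Pointwise R Q)
⊎-enumeration {R = R} {Q} EA EB = record
  { size = EA.size + EB.size
  ; encode = join EA.size EB.size ∘ ⊎-map EA.encode EB.encode
  ; decode = ⊎-map EA.decode EB.decode ∘ splitAt EA.size
  ; decode-encode = decode-encode }
  where
  module EA = Enumeration EA
  module EB = Enumeration EB
  decode-encode : ∀ t → Pointwise R Q (⊎-map EA.decode EB.decode
                     (splitAt EA.size (join EA.size EB.size (⊎-map EA.encode EB.encode t)))) t
  decode-encode (inj₁ a) rewrite splitAt-↑ˡ EA.size (EA.encode a) EB.size =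
    inj₁ (EA.decode-encode a)
  decode-encode (inj₂ b) rewrite splitAt-↑ʳ EA.size EB.size (EB.encode b) =
    inj₂ (EB.decode-encode b)

→-enumeration : {R : Rel A ℓ} (a : ℕ) → Enumeration A R →
                Enumeration (Fin a → A) (λ φ ψ → ∀ i → R (φ i) (ψ i))
→-enumeration {R = R} a E = record
  { size = size ^ a
  ; encode = λ φ → funToFin (encode ∘ φ)
  ; decode = λ j → decode ∘ finToFun j
  ; decode-encode = λ φ i → ≡.subst (λ j → R (decode j) (φ i))
                              (≡.sym (finToFun-funToFin (encode ∘ φ) i))
                              (decode-encode (φ i)) }
  where open Enumeration E

data ΣRel {a : ℕ} {B : Fin a → Set} (R : ∀ i → Rel (B i) ℓ) : Rel (Σ (Fin a) B) ℓ where
  same-index : ∀ {i x y} → R i x y → ΣRel R (i , x) (i , y)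

Σ-enumeration : (a : ℕ) {B : Fin a → Set} {R : ∀ i → Rel (B i) ℓ} →
                (∀ i → Enumeration (B i) (R i)) → Enumeration (Σ (Fin a) B) (ΣRel R)
Σ-enumeration zero E = record
  { size = 0 ; encode = λ { (() , _) } ; decode = λ () ; decode-encode = λ { (() , _) } }
Σ-enumeration (suc a) {B} {R} E = record
  { size = Head.size + Tail.size ; encode = encode ; decode = decode
  ; decode-encode = decode-encode }
  where
  module Head = Enumeration (E zero)
  module Tail = Enumeration (Σ-enumeration a (E ∘ suc))
  encode : Σ (Fin (suc a)) B → Fin (Head.size + Tail.size)
  encode (zero , x) = Head.encode x ↑ˡ Tail.size
  encode (suc i , x) = Head.size ↑ʳ Tail.encode (i , x)
  shift : Σ (Fin a) (B ∘ suc) → Σ (Fin (suc a)) B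
  shift (i , x) = suc i , x
  decode : Fin (Head.size + Tail.size) → Σ (Fin (suc a)) B
  decode = [ (λ j → zero , Head.decode j) , shift ∘ Tail.decode ]′ ∘ splitAt Head.size
  shift-ΣRel : ∀ {s t} → ΣRel (R ∘ suc) s t → ΣRel R (shift s) (shift t)
  shift-ΣRel (same-index r) = same-index r
  decode-encode : ∀ s → ΣRel R (decode (encode s)) s
  decode-encode (zero , x) rewrite splitAt-↑ˡ Head.size (Head.encode x) Tail.size =
    same-index (Head.decode-encode x)
  decode-encode (suc i , x) rewrite splitAt-↑ʳ Head.size Tail.size (Tail.encode (i , x)) =
    shift-ΣRel (Tail.decode-encode (i , x))

Sig-enumeration : (S : Signature) {X : Set} {R : Rel X ℓ} →
                  Enumeration X R → Enumeration (Sig S X) (SigRel S R)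
Sig-enumeration S E = weaken (λ { (same-index r) → sig-rel r })
  (Σ-enumeration (nops S) (λ o → →-enumeration (arity S o) E))

discrete : Set → Setoid 0ℓ 1ℓ
discrete A = record
  { Carrier = A
  ; _≈_ = λ x y → Lift 1ℓ (x ≡ y)
  ; isEquivalence = record
    { refl = lift ≡.refl
    ; sym = λ { (lift x≡y) → lift (≡.sym x≡y) }
    ; trans = λ { (lift x≡y) (lift y≡z) → lift (≡.trans x≡y y≡z) } } }

finite-coalgebra : ∀ {k} → (Fin k → FObj m (Fin k)) → Coalg m
finite-coalgebra {k = k} d = record
  { setoid = discrete (Fin k)
  ; str = d
  ; str-cong = λ { {x} (lift ≡.refl) → FRel-refl (λ _ → lift ≡.refl) (d x) } }

module Union {a : ℕ} (r : Fin a → Rat m) where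

  States : Set
  States = Σ[ i ∈ Fin a ] Fin (Rat.size (r i))

  str : States → FObj m States
  str (i , j) = FMap (i ,_) (Rat.trans (r i) j)

  embed : States → Rat m
  embed (i , j) = rat (Rat.size (r i)) (Rat.trans (r i)) j

  point : (i : Fin a) → States
  point i = i , Rat.state (r i)

  enumeration : Enumeration States _≡_
  enumeration = weaken (λ { (same-index ≡.refl) → ≡.refl })
    (Σ-enumeration a (λ i → Fin-enumeration (Rat.size (r i))))

pointed : {X : Set} → (X → FObj m X) → X → LObj m X
pointed c x = proj₁ (c x) , proj₂ (c x) , x

-- The coalgebra on the terms Σ X + X of depth at most one over a
-- coalgebra (X , c), whose structure is given by the specification:
-- a term σ(x₁,…,xₙ) steps as λ_X prescribes from the behaviour of the xᵢ.
module _ {S : Signature} (spec : BipointedSpec m S) where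

  term-str : (X : Setoid 0ℓ 1ℓ) → (Setoid.Carrier X → FObj m (Setoid.Carrier X)) →
             Sig S (Setoid.Carrier X) ⊎ Setoid.Carrier X →
             FObj m (Sig S (Setoid.Carrier X) ⊎ Setoid.Carrier X)
  term-str X c (inj₁ t) = lam spec X (SigMap S (pointed c) t)
  term-str X c (inj₂ x) = FMap inj₂ (c x)

module Restriction (m : ℕ) (S : Signature) (spec : BipointedSpec m S)
  (N : Coalg m) (N-final : IsFinal N)
  (α : Sig S (Coalg.Carrier N) → Coalg.Carrier N) (α-induced : IsInducedAlgebra spec N α)
  (h : Rat m → Coalg.Carrier N)
  (h-hom : IsHom m _≈ρ_ ratStr (Coalg._≈_ N) (Coalg.str N) h) where

  open Coalg N using (Carrier; _≈_; str; setoid; str-cong)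
  module ≈ = Setoid setoid

  α-cong : ∀ {u v} → SigRel S _≈_ u v → α u ≈ α v
  α-cong = proj₁ α-induced

  h-str : ∀ x → FRel m _≈_ (FMap h (ratStr x)) (str (h x))
  h-str = proj₂ h-hom

  rat-hom : ∀ {k} (d : Fin k → FObj m (Fin k)) →
            IsCoalgHom (finite-coalgebra d) N (h ∘ rat k d)
  rat-hom {k} d = (λ { (lift ≡.refl) → ≈.refl }) , λ j → FRel-map-∘ˡ (h-str (rat k d j))

  behaviour-unique : ∀ {k} (d : Fin k → FObj m (Fin k)) (g : Fin k → Carrier) →
                     (∀ j → FRel m _≈_ (FMap g (d j)) (str (g j))) →
                     ∀ j → h (rat k d j) ≈ g j
  behaviour-unique d g g-hom =
    proj₂ (N-final (finite-coalgebra d)) (h ∘ rat _ d) g (rat-hom d)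
          ((λ { (lift ≡.refl) → ≈.refl }) , g-hom)

  -- h reflects equality: on finite coalgebras its kernel is a bisimulation,
  -- since h is a homomorphism and str respects ≈
  h-reflects : ∀ x y → h x ≈ h y → x ≈ρ y
  h-reflects (rat n c i) (rat k d j) =
    GreatestBisimulation.bisimulation⇒≈ρ c d kernel kernel-bisim i j
    where
    kernel : Fin n → Fin k → Set₁
    kernel x y = h (rat n c x) ≈ h (rat k d y)
    kernel-bisim : ∀ x y → kernel x y → FRel m kernel (c x) (d y)
    kernel-bisim x y hx≈hy = FRel-mapʳ⁻ (FRel-mapʳ⁻ (FRel-mapˡ⁻ (FRel-mapˡ⁻
      (FRel-trans ≈.trans (h-str (rat n c x))
        (FRel-trans ≈.trans (str-cong hx≈hy) (FRel-sym ≈.sym (h-str (rat k d y))))))))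

  finitise : {T : Set} {_~_ : Rel T ℓ} → Enumeration T _~_ → (T → FObj m T) → T → Rat m
  finitise E s t = rat size (FMap encode ∘ s ∘ decode) (encode t)
    where open Enumeration E

  finitise-behaviour : {T : Set} {_~_ : Rel T ℓ} (E : Enumeration T _~_)
    (s : T → FObj m T) (g : T → Carrier) →
    (∀ {t t'} → t ~ t' → g t ≈ g t') →
    (∀ t → FRel m _≈_ (FMap g (s t)) (str (g t))) →
    ∀ t → h (finitise E s t) ≈ g t
  finitise-behaviour E s g g-resp g-hom t =
    ≈.trans (behaviour-unique (FMap encode ∘ s ∘ decode) (g ∘ decode) decoded-hom (encode t))
            (g-resp (decode-encode t))
    where
    open Enumeration E
    decoded-hom : ∀ j → FRel m _≈_ (FMap (g ∘ decode) (FMap encode (s (decode j))))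
                                     (str (g (decode j)))
    decoded-hom j = FRel-mapˡ (FRel-mapˡ
      (FRel-mono (λ gt≈ → ≈.trans (g-resp (decode-encode _)) gt≈) (FRel-mapˡ⁻ (g-hom (decode j)))))

  SigRel-trans : ∀ {u v w} → SigRel S _≈_ u v → SigRel S _≈_ v w → SigRel S _≈_ u w
  SigRel-trans (sig-rel u≈v) (sig-rel v≈w) = sig-rel (λ i → ≈.trans (u≈v i) (v≈w i))

  -- The specification lifts homomorphisms: if f : (X , c) → N is a
  -- homomorphism, so is [α ∘ Σf , f] from the term coalgebra over (X , c).
  -- This is where naturality of λ and the defining equation of α are used.
  module Extension (X : Setoid 0ℓ 1ℓ) (c : Setoid.Carrier X → FObj m (Setoid.Carrier X))
           (f : Setoid.Carrier X → Carrier)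
           (f-hom : IsHom m (Setoid._≈_ X) c _≈_ str f) where

    extend : Sig S (Setoid.Carrier X) ⊎ Setoid.Carrier X → Carrier
    extend = [ α ∘ SigMap S f , f ]

    extend-resp : ∀ {t t'} → Pointwise (SigRel S _≡_) _≡_ t t' → extend t ≈ extend t'
    extend-resp (inj₁ (sig-rel xs≡ys)) = α-cong (sig-rel (λ i → ≈.reflexive (≡.cong f (xs≡ys i))))
    extend-resp (inj₂ ≡.refl) = ≈.refl

    extend-hom : ∀ t → FRel m _≈_ (FMap extend (term-str spec X c t)) (str (extend t))
    extend-hom (inj₂ x) = FRel-map-∘ˡ⁻ (proj₂ f-hom x)
    extend-hom (inj₁ t@(o , xs)) =
      FRel-trans ≈.trans via-N (FRel-sym ≈.sym (proj₂ α-induced (SigMap S f t)))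
      where
      PW : Rel (Sig S Carrier ⊎ Carrier) 1ℓ
      PW = Pointwise (SigRel S _≈_) _≈_
      natural : FRel m PW (FMap (⊎-map (SigMap S f) f) (lam spec X (SigMap S (pointed c) t)))
                          (lam spec setoid (SigMap S (pointed str) (SigMap S f t)))
      natural = FRel-trans (⊎-transitive SigRel-trans ≈.trans)
        (lam-natural spec X setoid f (proj₁ f-hom) (SigMap S (pointed c) t))
        (lam-cong spec setoid (sig-rel (λ i → proj₂ f-hom (xs i) , ≈.refl)))
      evaluate : ∀ {s s'} → PW (⊎-map (SigMap S f) f s) s' → extend s ≈ [ α , id ] s'
      evaluate {inj₁ _} (inj₁ σ≈) = α-cong σ≈
      evaluate {inj₂ _} (inj₂ x≈) = x≈
      via-N : FRel m _≈_ (FMap extend (lam spec X (SigMap S (pointed c) t)))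
                         (FMap [ α , id ] (lam spec setoid (SigMap S (pointed str) (SigMap S f t))))
      via-N = FRel-mapˡ (FRel-mapʳ (FRel-mono (λ {s} → evaluate {s}) (FRel-mapˡ⁻ natural)))

  module Operation {o : Fin (nops S)} (r : Fin (arity S o) → Rat m) where
    module U = Union r

    States : Set
    States = Sig S U.States ⊎ U.States

    terms : Enumeration States (Pointwise (SigRel S _≡_) _≡_)
    terms = ⊎-enumeration (Sig-enumeration S U.enumeration) U.enumeration

    term : States
    term = inj₁ (o , U.point)

    term-coalgebra : States → FObj m States
    term-coalgebra = term-str spec (discrete U.States) U.str

    union-hom : IsHom m (Setoid._≈_ (discrete U.States)) U.str _≈_ str (h ∘ U.embed)
    union-hom = (λ { (lift ≡.refl) → ≈.refl }) ,
                λ s → FRel-map-∘ˡ⁻ (FRel-map-∘ˡ (h-str (U.embed s)))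

    result : Rat m
    result = finitise terms term-coalgebra term

    -- extend term is α (SigMap S h (o , r)) by η for the record Rat
    result-behaviour : h result ≈ α (SigMap S h (o , r))
    result-behaviour =
      finitise-behaviour terms term-coalgebra extend extend-resp extend-hom term
      where open Extension (discrete U.States) U.str (h ∘ U.embed) union-hom

  β : Sig S (Rat m) → Rat m
  β (_ , r) = Operation.result r

  β-behaviour : ∀ u → h (β u) ≈ α (SigMap S h u)
  β-behaviour (_ , r) = Operation.result-behaviour r

  β-cong : ∀ {u v} → SigRel S _≈ρ_ u v → β u ≈ρ β v
  β-cong {u} {v} (sig-rel r≈r') = h-reflects (β u) (β v) (begin
    h (β u)              ≈⟨ β-behaviour u ⟩
    α (SigMap S h u)     ≈⟨ α-cong (sig-rel (λ i → proj₁ h-hom (r≈r' i))) ⟩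
    α (SigMap S h v)     ≈⟨ β-behaviour v ⟨
    h (β v)              ∎)
    where open SetoidReasoning setoid

corollary5p5 : (m : ℕ) (S : Signature) (spec : BipointedSpec m S)
    (N : Coalg m) → IsFinal N →
    (α : Sig S (Coalg.Carrier N) → Coalg.Carrier N) →
    IsInducedAlgebra spec N α →
    (h : Rat m → Coalg.Carrier N) →
    IsHom m _≈ρ_ ratStr (Coalg._≈_ N) (Coalg.str N) h →
    Σ[ β ∈ (Sig S (Rat m) → Rat m) ]
      ((∀ {u v} → SigRel S _≈ρ_ u v → β u ≈ρ β v) ×
       (∀ u → Coalg._≈_ N (h (β u)) (α (SigMap S h u))))
corollary5p5 m S spec N N-final α α-induced h h-hom =
  β , (λ {u} {v} → β-cong {u} {v}) , β-behaviour
  where open Restriction m S spec N N-final α α-induced h h-hom
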